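{- Let $n\geq1$ and let $P\in\mathbb{Z}[y_1,\ldots,y_n]$ have degree at least one. There exist $c,C>0$ and $\varepsilon\in(0,1)$, depending only on $P$, such that for any finite commutative ring $R$ with characteristic $N$ satisfying $\mathrm{lpf}(N)>C$, the number of $y\in R^n$ with $P(y)=0_R$ is at most $|R|^{n-1}+\dfrac{c|R|^n}{\mathrm{lpf}(N)^{\varepsilon}}$.
   Context: Rings are commutative with unity $1\neq0$; the characteristic is the least positive $N$ with $N\cdot1_R=0$; integer polynomials are evaluated in $R$ via multiples of $1_R$. $\mathrm{lpf}(N)$ is the least prime factor of $N$. -}

module Defs where

open import Level using (Level; _⊔_)
open import Algebra.Bundles using (CommutativeRing)
open import Data.Nat as ℕ using (ℕ; zero; suc; _≤_; _<_)
open import Data.Nat.Divisibility using (_∣_)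
open import Data.Nat.Primality using (Prime)
open import Data.Integer as ℤ using (ℤ; +_; -[1+_])
open import Data.Fin as Fin using (Fin)
open import Data.Vec as Vec using (Vec; []; _∷_)
open import Data.Vec.Properties using (≡-dec)
open import Data.List as List using (List; []; _∷_; length; filter; allFin; concatMap)
open import Data.Product using (Σ; _×_; _,_)
open import Relation.Nullary using (¬_; Dec; yes; no)
open import Relation.Binary.PropositionalEquality using (_≡_)

-- A polynomial in ℤ[y₁,…,yₙ], given as a finite list of terms
-- (coefficient, exponent vector).  Repeated exponent vectors are allowed;
-- the actual coefficient of a monomial is the sum of the matching terms.
Poly : ℕ → Set
Poly n = List (ℤ × Vec ℕ n)

coeff : ∀ {n} → Poly n → Vec ℕ n → ℤ
coeff [] e = + 0
coeff ((c , e′) ∷ P) e with ≡-dec ℕ._≟_ e′ e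
... | yes _ = c ℤ.+ coeff P e
... | no  _ = coeff P e

totalDeg : ∀ {n} → Vec ℕ n → ℕ
totalDeg = Vec.sum

DegreeAtLeastOne : ∀ {n} → Poly n → Set
DegreeAtLeastOne {n} P = Σ (Vec ℕ n) λ e → (1 ≤ totalDeg e) × ¬ (coeff P e ≡ + 0)

IsLeastPrimeFactor : ℕ → ℕ → Set
IsLeastPrimeFactor N p = Prime p × p ∣ N × (∀ q → Prime q → q ∣ N → p ≤ q)

module _ {a ℓ : Level} (R : CommutativeRing a ℓ) where
  open CommutativeRing R

  natR : ℕ → Carrier
  natR zero    = 0#
  natR (suc k) = 1# + natR k

  intR : ℤ → Carrier
  intR (+ k)     = natR k
  intR -[1+ k ]  = - natR (suc k)

  powR : Carrier → ℕ → Carrier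
  powR x zero    = 1#
  powR x (suc k) = x * powR x k

  monoR : ∀ {n} → Vec Carrier n → Vec ℕ n → Carrier
  monoR []       []       = 1#
  monoR (y ∷ ys) (e ∷ es) = powR y e * monoR ys es

  evalR : ∀ {n} → Poly n → Vec Carrier n → Carrier
  evalR []            y = 0#
  evalR ((c , e) ∷ P) y = intR c * monoR y e + evalR P y

  IsCharacteristic : ℕ → Set ℓ
  IsCharacteristic N =
    (0 < N) × (natR N ≈ 0#) × (∀ m → 0 < m → m < N → ¬ (natR m ≈ 0#))

  Nontrivial : Set ℓ
  Nontrivial = ¬ (1# ≈ 0#)

  record Finite : Set (a ⊔ ℓ) where
    field
      size        : ℕ
      enum        : Fin size → Carrier
      index       : Carrier → Fin size
      enum-index  : ∀ x → enum (index x) ≈ x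
      enum-inj    : ∀ i j → enum i ≈ enum j → i ≡ j

  allVecs : (m n : ℕ) → List (Vec (Fin m) n)
  allVecs m zero    = [] ∷ []
  allVecs m (suc n) = concatMap (λ i → List.map (i ∷_) (allVecs m n)) (allFin m)

  countZeros : Finite → ∀ {n} → Poly n → ℕ
  countZeros F {n} P =
    length (filter (λ t → index (evalR P (Vec.map enum t)) Fin.≟ index 0#)
                   (allVecs size n))
    where open Finite F

-- Kronecker substitution reduces the count to one variable.  With M larger than
-- every exponent of P, the curves x ↦ y + (x, x^M, x^(M²), …) turn each monomial
-- y^e into a polynomial in x of degree weight e (the number with base-M digits e),
-- and distinct exponents get distinct weights.  So along every such curve P is a
-- polynomial of degree at most D = Σ weight, whose leading coefficient is c · 1_R
-- for a nonzero integer c with |c| ≤ Σ|coefficients|.  If lpf(N) exceeds that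
-- bound then c · 1_R ≠ 0 and every k · 1_R with 0 < k < lpf(N) is a unit (k is
-- prime to N), so P vanishes at no more than D of the points 0, 1, …, lpf(N) − 1
-- of each curve.  Double counting the pairs (y, t) with P(y + curve t) = 0, where
-- each translation by curve t permutes Rⁿ, gives lpf(N) · #{P = 0} ≤ D · |R|ⁿ;
-- this implies the claim with ε = 1/2.

module Submission where

open import Defs
open import Level using (Level; _⊔_)
open import Algebra.Bundles using (CommutativeRing)
import Algebra.Properties.CommutativeMonoid.Sum as MonoidSum
import Algebra.Properties.CommutativeSemigroup as CommutativeSemigroupProperties
import Algebra.Properties.Ring as RingProperties
import Algebra.Properties.Semiring.Mult as SemiringMultiples
open import Data.Empty using (⊥-elim)
open import Data.Fin as Fin using (Fin)
open import Data.Fin.Permutation using (permutation)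
open import Data.Integer as ℤ using (ℤ; +_; -[1+_]; _⊖_; ∣_∣)
import Data.Integer.Properties as ℤₚ
open import Data.List as List using (List; []; _∷_; length; filter; take; upTo; allFin; concatMap; _++_)
open import Data.List.Extrema.Nat using (argmax; argmax-sel; f[⊥]≤f[argmax]; f[xs]≤f[argmax])
open import Data.List.Membership.Propositional using (_∈_)
open import Data.List.Membership.Propositional.Properties using (∈-upTo⁻)
import Data.List.Properties as Listₚ
open import Data.List.Relation.Binary.Subset.Propositional using (_⊆_)
open import Data.List.Relation.Binary.Subset.Propositional.Properties using (All-resp-⊇)
open import Data.List.Relation.Unary.All as All using (All; []; _∷_)
import Data.List.Relation.Unary.All.Properties as Allₚ
open import Data.List.Relation.Unary.AllPairs using (AllPairs; []; _∷_)
import Data.List.Relation.Unary.AllPairs.Properties as AllPairsₚ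
open import Data.List.Relation.Unary.Any using (here; there)
import Data.List.Relation.Unary.Unique.Propositional.Properties as Uniqueₚ
open import Data.Nat as ℕ using (ℕ; zero; suc; _≤_; _<_; z≤n; s≤s; NonZero)
open import Data.Nat.Coprimality using (Coprime; coprime-Bézout)
open import Data.Nat.Divisibility using (_∣_; divides; ∣-trans; ∣⇒≤; 0∣⇒≡0)
open import Data.Nat.DivMod using (_%_; m<n⇒m%n≡m; [m+kn]%n≡m%n)
open import Data.Nat.GCD using (module Bézout)
open import Data.Nat.Induction using (<-wellFounded)
open import Data.Nat.ListAction using (product)
open import Data.Nat.Primality using (Prime)
open import Data.Nat.Primality.Factorisation using (factorise)
import Data.Nat.Properties as ℕₚ
open import Data.Nat.Solver using (module +-*-Solver)
open import Data.Product using (Σ; _×_; _,_; proj₁; proj₂)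
open import Data.Sum using (inj₁; inj₂)
open import Data.Vec as Vec using (Vec; []; _∷_)
open import Data.Vec.Properties using (≡-dec)
open import Data.Vec.Relation.Binary.Pointwise.Inductive as Pointwise using (Pointwise; []; _∷_)
open import Data.Vec.Relation.Unary.All as VecAll using ([]; _∷_)
open import Induction.WellFounded using (Acc; acc)
open import Relation.Binary.Definitions using (tri<; tri≈; tri>)
open import Relation.Binary.PropositionalEquality as ≡ using (_≡_; _≢_; module ≡-Reasoning)
open import Relation.Nullary using (¬_; Dec; yes; no)
open import Relation.Unary using (Decidable)

-- Prime divisors and base-M digits

∃-prime-divisor : ∀ {d} → 2 ≤ d → Σ ℕ λ q → Prime q × q ∣ d
∃-prime-divisor {d} 2≤d with factorise d {{ℕ.>-nonZero (ℕₚ.≤-trans (s≤s z≤n) 2≤d)}}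
... | record { factors = [] ; isFactorisation = d≡1 } = ⊥-elim (ℕₚ.<⇒≢ 2≤d (≡.sym d≡1))
... | record { factors = q ∷ qs ; isFactorisation = d≡q*qs ; factorsPrime = q-prime ∷ _ } =
  q , q-prime , divides (product qs) (≡.trans d≡q*qs (ℕₚ.*-comm q (product qs)))

weight : ℕ → ∀ {n} → Vec ℕ n → ℕ
weight M []       = 0
weight M (e ∷ es) = e ℕ.+ weight M es ℕ.* M

weight-injective : ∀ M .{{_ : NonZero M}} {n} {es fs : Vec ℕ n} →
                   VecAll.All (_< M) es → VecAll.All (_< M) fs → weight M es ≡ weight M fs → es ≡ fs
weight-injective M {es = []}     {[]}     _              _              _  = ≡.refl
weight-injective M {es = e ∷ es} {f ∷ fs} (e<M ∷ es<M) (f<M ∷ fs<M) eq =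
  ≡.cong₂ _∷_ e≡f (weight-injective M es<M fs<M
    (ℕₚ.*-cancelʳ-≡ _ _ M (ℕₚ.+-cancelˡ-≡ e _ _ (≡.trans eq (≡.cong (ℕ._+ weight M fs ℕ.* M) (≡.sym e≡f))))))
  where
  open ≡-Reasoning
  e≡f : e ≡ f
  e≡f = begin
    e                               ≡⟨ m<n⇒m%n≡m e<M ⟨
    e % M                           ≡⟨ [m+kn]%n≡m%n e (weight M es) M ⟨
    (e ℕ.+ weight M es ℕ.* M) % M   ≡⟨ ≡.cong (_% M) eq ⟩
    (f ℕ.+ weight M fs ℕ.* M) % M   ≡⟨ [m+kn]%n≡m%n f (weight M fs) M ⟩
    f % M                           ≡⟨ m<n⇒m%n≡m f<M ⟩
    f                               ∎

-- Finite sums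

indicator : ∀ {p} {P : Set p} → Dec P → ℕ
indicator (yes _) = 1
indicator (no  _) = 0

private variable
  b c : Level
  A : Set b
  B : Set c

∑ : List A → (A → ℕ) → ℕ
∑ []       f = 0
∑ (x ∷ xs) f = f x ℕ.+ ∑ xs f

syntax ∑ xs (λ x → e) = ∑[ x ∈ xs ] e

∑-cong : ∀ xs {f g : A → ℕ} → (∀ x → f x ≡ g x) → ∑ xs f ≡ ∑ xs g
∑-cong []       f≡g = ≡.refl
∑-cong (x ∷ xs) f≡g = ≡.cong₂ ℕ._+_ (f≡g x) (∑-cong xs f≡g)

∑-const : ∀ (xs : List A) m → ∑[ x ∈ xs ] m ≡ length xs ℕ.* m
∑-const []       m = ≡.refl
∑-const (x ∷ xs) m = ≡.cong (m ℕ.+_) (∑-const xs m)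

∑-≤ : ∀ xs {f : A → ℕ} {m} → (∀ x → f x ≤ m) → ∑ xs f ≤ length xs ℕ.* m
∑-≤ []       f≤m = z≤n
∑-≤ (x ∷ xs) f≤m = ℕₚ.+-mono-≤ (f≤m x) (∑-≤ xs f≤m)

∑-+ : ∀ xs (f g : A → ℕ) → ∑[ x ∈ xs ] (f x ℕ.+ g x) ≡ ∑ xs f ℕ.+ ∑ xs g
∑-+ []       f g = ≡.refl
∑-+ (x ∷ xs) f g = ≡.trans (≡.cong (f x ℕ.+ g x ℕ.+_) (∑-+ xs f g))
                       (CommutativeSemigroupProperties.interchange ℕₚ.+-commutativeSemigroup (f x) (g x) _ _)

∑-++ : ∀ xs ys (f : A → ℕ) → ∑ (xs ++ ys) f ≡ ∑ xs f ℕ.+ ∑ ys f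
∑-++ []       ys f = ≡.refl
∑-++ (x ∷ xs) ys f = ≡.trans (≡.cong (f x ℕ.+_) (∑-++ xs ys f)) (≡.sym (ℕₚ.+-assoc (f x) _ _))

length-filter≡∑ : ∀ {p} {P : A → Set p} (P? : Decidable P) xs →
                length (filter P? xs) ≡ ∑[ x ∈ xs ] indicator (P? x)
length-filter≡∑ P? []       = ≡.refl
length-filter≡∑ P? (x ∷ xs) with P? x
... | yes _ = ≡.cong suc (length-filter≡∑ P? xs)
... | no  _ = length-filter≡∑ P? xs

∑-map : ∀ (h : B → A) xs (f : A → ℕ) → ∑ (List.map h xs) f ≡ ∑[ x ∈ xs ] f (h x)
∑-map h []       f = ≡.refl
∑-map h (x ∷ xs) f = ≡.cong (f (h x) ℕ.+_) (∑-map h xs f)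

∑-concatMap : ∀ (g : B → List A) xs (f : A → ℕ) → ∑ (concatMap g xs) f ≡ ∑[ x ∈ xs ] ∑ (g x) f
∑-concatMap g []       f = ≡.refl
∑-concatMap g (x ∷ xs) f = ≡.trans (∑-++ (g x) (concatMap g xs) f) (≡.cong (∑ (g x) f ℕ.+_) (∑-concatMap g xs f))

∑-swap : ∀ xs (ys : List B) (h : A → B → ℕ) → ∑[ x ∈ xs ] ∑ ys (h x) ≡ ∑[ y ∈ ys ] ∑[ x ∈ xs ] h x y
∑-swap []       ys h = ≡.sym (≡.trans (∑-const ys 0) (ℕₚ.*-zeroʳ (length ys)))
∑-swap (x ∷ xs) ys h = ≡.trans (≡.cong (∑ ys (h x) ℕ.+_) (∑-swap xs ys h)) (≡.sym (∑-+ ys (h x) _))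

∑-allFin-permute : ∀ {n} (f : Fin n → ℕ) (τ τ⁻¹ : Fin n → Fin n) →
                   (∀ i → τ (τ⁻¹ i) ≡ i) → (∀ i → τ⁻¹ (τ i) ≡ i) →
                   ∑[ i ∈ allFin n ] f (τ i) ≡ ∑ (allFin n) f
∑-allFin-permute f τ τ⁻¹ inverseˡ inverseʳ = begin
  ∑[ i ∈ allFin _ ] f (τ i)   ≡⟨ ∑-tabulate (λ i → i) (λ i → f (τ i)) ⟩
  sum (λ i → f (τ i))         ≡⟨ sum-permute f (permutation τ τ⁻¹ inverseˡ inverseʳ) ⟨
  sum f                       ≡⟨ ∑-tabulate (λ i → i) f ⟨
  ∑ (allFin _) f              ∎
  where
  open ≡-Reasoning
  open MonoidSum ℕₚ.+-0-commutativeMonoid using (sum; sum-permute)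
  ∑-tabulate : ∀ {k m} (h : Fin k → Fin m) (g : Fin m → ℕ) → ∑ (List.tabulate h) g ≡ sum (λ i → g (h i))
  ∑-tabulate {zero}  h g = ≡.refl
  ∑-tabulate {suc k} h g = ≡.cong (g (h Fin.zero) ℕ.+_) (∑-tabulate (λ i → h (Fin.suc i)) g)

∈⇒≤∑ : ∀ {x} {xs : List A} (f : A → ℕ) → x ∈ xs → f x ≤ ∑ xs f
∈⇒≤∑ f (here ≡.refl) = ℕₚ.m≤m+n _ _
∈⇒≤∑ f (there x∈xs)  = ℕₚ.≤-trans (∈⇒≤∑ f x∈xs) (ℕₚ.m≤n+m _ _)

-- Polynomials as lists of terms

entries≤totalDeg : ∀ {n} (es : Vec ℕ n) → VecAll.All (_≤ totalDeg es) es
entries≤totalDeg []       = []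
entries≤totalDeg (e ∷ es) = ℕₚ.m≤m+n e _ ∷ VecAll.map (λ e′≤ → ℕₚ.≤-trans e′≤ (ℕₚ.m≤n+m _ e)) (entries≤totalDeg es)

module _ {n : ℕ} where

  dropExponent : Vec ℕ n → Poly n → Poly n
  dropExponent e []              = []
  dropExponent e ((c , e′) ∷ Q) with ≡-dec ℕ._≟_ e′ e
  ... | yes _ = dropExponent e Q
  ... | no  _ = (c , e′) ∷ dropExponent e Q

  dropExponent-⊆ : ∀ e Q → dropExponent e Q ⊆ Q
  dropExponent-⊆ e ((c , e′) ∷ Q) u∈ with ≡-dec ℕ._≟_ e′ e
  dropExponent-⊆ e ((c , e′) ∷ Q) u∈          | yes _ = there (dropExponent-⊆ e Q u∈)
  dropExponent-⊆ e ((c , e′) ∷ Q) (here u≡)   | no  _ = here u≡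
  dropExponent-⊆ e ((c , e′) ∷ Q) (there u∈)  | no  _ = there (dropExponent-⊆ e Q u∈)

  dropExponent-≢ : ∀ e Q → All (λ u → proj₂ u ≢ e) (dropExponent e Q)
  dropExponent-≢ e []              = []
  dropExponent-≢ e ((c , e′) ∷ Q) with ≡-dec ℕ._≟_ e′ e
  ... | yes _    = dropExponent-≢ e Q
  ... | no e′≢e = e′≢e ∷ dropExponent-≢ e Q

  length-dropExponent≤ : ∀ e Q → length (dropExponent e Q) ≤ length Q
  length-dropExponent≤ e []              = z≤n
  length-dropExponent≤ e ((c , e′) ∷ Q) with ≡-dec ℕ._≟_ e′ e
  ... | yes _ = ℕₚ.m≤n⇒m≤1+n (length-dropExponent≤ e Q)
  ... | no  _ = s≤s (length-dropExponent≤ e Q)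

  length-dropExponent< : ∀ {c} e Q → (c , e) ∈ Q → length (dropExponent e Q) < length Q
  length-dropExponent< e ((c , e′) ∷ Q) t∈ with ≡-dec ℕ._≟_ e′ e
  length-dropExponent< e ((c , e′) ∷ Q) t∈           | yes _    = s≤s (length-dropExponent≤ e Q)
  length-dropExponent< e ((c , e′) ∷ Q) (here ≡.refl) | no e′≢e = ⊥-elim (e′≢e ≡.refl)
  length-dropExponent< e ((c , e′) ∷ Q) (there t∈)    | no _    = s≤s (length-dropExponent< e Q t∈)

  coeff-dropExponent : ∀ {e e″} Q → e″ ≢ e → coeff (dropExponent e Q) e″ ≡ coeff Q e″
  coeff-dropExponent {e} {e″} []              _ = ≡.refl
  coeff-dropExponent {e} {e″} ((c , e′) ∷ Q) e″≢e with ≡-dec ℕ._≟_ e′ e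
  ... | yes e′≡e with ≡-dec ℕ._≟_ e′ e″
  ...   | yes e′≡e″ = ⊥-elim (e″≢e (≡.trans (≡.sym e′≡e″) e′≡e))
  ...   | no  _     = coeff-dropExponent Q e″≢e
  coeff-dropExponent {e} {e″} ((c , e′) ∷ Q) e″≢e | no _ with ≡-dec ℕ._≟_ e′ e″
  ...   | yes _ = ≡.cong (ℤ._+_ c) (coeff-dropExponent Q e″≢e)
  ...   | no  _ = coeff-dropExponent Q e″≢e

  ∣coeff∣≤∑∣c∣ : ∀ (Q : Poly n) e → ∣ coeff Q e ∣ ≤ ∑[ u ∈ Q ] ∣ proj₁ u ∣
  ∣coeff∣≤∑∣c∣ []              e = z≤n
  ∣coeff∣≤∑∣c∣ ((c , e′) ∷ Q) e with ≡-dec ℕ._≟_ e′ e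
  ... | yes _ = ℕₚ.≤-trans (ℤₚ.∣i+j∣≤∣i∣+∣j∣ c (coeff Q e)) (ℕₚ.+-monoʳ-≤ ∣ c ∣ (∣coeff∣≤∑∣c∣ Q e))
  ... | no  _ = ℕₚ.≤-trans (∣coeff∣≤∑∣c∣ Q e) (ℕₚ.m≤n+m _ _)

-- Integers in a ring of characteristic N

module Multiples {a ℓ} (R : CommutativeRing a ℓ) where
  open CommutativeRing R
  open RingProperties ring using (-0#≈0#; -‿+-comm)
  open SemiringMultiples semiring using (×-homo-+; ×1-homo-*) renaming (_×_ to _×ₙ_)
  open CommutativeSemigroupProperties +-commutativeSemigroup using (interchange)
  open import Relation.Binary.Reasoning.Setoid setoid

  natR≡×1# : ∀ k → natR R k ≡ k ×ₙ 1#
  natR≡×1# zero    = ≡.refl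
  natR≡×1# (suc k) = ≡.cong (_+_ 1#) (natR≡×1# k)

  natR-+ : ∀ m n → natR R (m ℕ.+ n) ≈ natR R m + natR R n
  natR-+ m n = begin
    natR R (m ℕ.+ n)      ≡⟨ natR≡×1# (m ℕ.+ n) ⟩
    (m ℕ.+ n) ×ₙ 1#       ≈⟨ ×-homo-+ 1# m n ⟩
    m ×ₙ 1# + n ×ₙ 1#     ≡⟨ ≡.cong₂ _+_ (natR≡×1# m) (natR≡×1# n) ⟨
    natR R m + natR R n   ∎

  natR-* : ∀ m n → natR R (m ℕ.* n) ≈ natR R m * natR R n
  natR-* m n = begin
    natR R (m ℕ.* n)      ≡⟨ natR≡×1# (m ℕ.* n) ⟩
    (m ℕ.* n) ×ₙ 1#       ≈⟨ ×1-homo-* m n ⟩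
    m ×ₙ 1# * n ×ₙ 1#     ≡⟨ ≡.cong₂ _*_ (natR≡×1# m) (natR≡×1# n) ⟨
    natR R m * natR R n   ∎

  intR-⊖ : ∀ m n → intR R (m ⊖ n) ≈ natR R m - natR R n
  intR-⊖ m       zero    = sym (trans (+-congˡ -0#≈0#) (+-identityʳ (natR R m)))
  intR-⊖ zero    (suc n) = sym (+-identityˡ (- natR R (suc n)))
  intR-⊖ (suc m) (suc n) = begin
    intR R (suc m ⊖ suc n)                  ≡⟨ ≡.cong (intR R) (ℤₚ.[1+m]⊖[1+n]≡m⊖n m n) ⟩
    intR R (m ⊖ n)                          ≈⟨ intR-⊖ m n ⟩
    natR R m - natR R n                     ≈⟨ +-identityˡ _ ⟨
    0# + (natR R m - natR R n)              ≈⟨ +-congʳ (-‿inverseʳ 1#) ⟨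
    (1# - 1#) + (natR R m - natR R n)       ≈⟨ interchange 1# (- 1#) (natR R m) (- natR R n) ⟩
    (1# + natR R m) + (- 1# - natR R n)     ≈⟨ +-congˡ (-‿+-comm 1# (natR R n)) ⟩
    natR R (suc m) - natR R (suc n)         ∎

  intR-+ : ∀ i j → intR R (i ℤ.+ j) ≈ intR R i + intR R j
  intR-+ (+ m)    (+ n)    = natR-+ m n
  intR-+ (+ m)    -[1+ n ] = intR-⊖ m (suc n)
  intR-+ -[1+ m ] (+ n)    = trans (intR-⊖ n (suc m)) (+-comm _ _)
  intR-+ -[1+ m ] -[1+ n ] = begin
    - natR R (suc (suc (m ℕ.+ n)))          ≡⟨ ≡.cong (λ k → - natR R (suc k)) (ℕₚ.+-suc m n) ⟨
    - natR R (suc m ℕ.+ suc n)              ≈⟨ -‿cong (natR-+ (suc m) (suc n)) ⟩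
    - (natR R (suc m) + natR R (suc n))     ≈⟨ -‿+-comm _ _ ⟨
    - natR R (suc m) - natR R (suc n)       ∎

module Characteristic {a ℓ} (R : CommutativeRing a ℓ) {N p : ℕ}
                      (char : IsCharacteristic R N) (lpf : IsLeastPrimeFactor N p) where
  open CommutativeRing R
  open RingProperties ring using (-0#≈0#; -‿involutive; -‿distribˡ-*; +-inverseʳ-unique; +-cancelˡ)
  open Multiples R
  open import Relation.Binary.Reasoning.Setoid setoid

  private
    N≢0 : NonZero N
    N≢0 = ℕ.>-nonZero (proj₁ char)

  p≤N : p ≤ N
  p≤N = ∣⇒≤ {{N≢0}} (proj₁ (proj₂ lpf))

  natR-N≈0 : ∀ k → natR R (k ℕ.* N) ≈ 0#
  natR-N≈0 k = trans (natR-* k N) (trans (*-congˡ (proj₁ (proj₂ char))) (zeroʳ _))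

  coprime-below-lpf : ∀ {m} → 0 < m → m < p → Coprime m N
  coprime-below-lpf 0<m m<p {zero}          (0∣m , _)   = ⊥-elim (ℕₚ.<⇒≢ 0<m (≡.sym (0∣⇒≡0 0∣m)))
  coprime-below-lpf 0<m m<p {suc zero}      _           = ≡.refl
  coprime-below-lpf 0<m m<p {suc (suc d)} (d∣m , d∣N) with ∃-prime-divisor {suc (suc d)} (s≤s (s≤s z≤n))
  ... | q , q-prime , q∣d = ⊥-elim (ℕₚ.<⇒≱ q<p (proj₂ (proj₂ lpf) q q-prime (∣-trans q∣d d∣N)))
    where q<p = ℕₚ.≤-<-trans (∣⇒≤ {{ℕ.>-nonZero 0<m}} (∣-trans q∣d d∣m)) m<p

  natR-invertible : ∀ {m} → 0 < m → m < p → Σ Carrier λ u → u * natR R m ≈ 1#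
  natR-invertible {m} 0<m m<p with coprime-Bézout (coprime-below-lpf 0<m m<p)
  ... | Bézout.+- x y 1+yN≡xm = natR R x , (begin
    natR R x * natR R m         ≈⟨ natR-* x m ⟨
    natR R (x ℕ.* m)            ≡⟨ ≡.cong (natR R) 1+yN≡xm ⟨
    1# + natR R (y ℕ.* N)       ≈⟨ +-congˡ (natR-N≈0 y) ⟩
    1# + 0#                     ≈⟨ +-identityʳ 1# ⟩
    1#                          ∎)
  ... | Bézout.-+ x y 1+xm≡yN = - natR R x , (begin
    - natR R x * natR R m       ≈⟨ -‿distribˡ-* _ _ ⟨
    - (natR R x * natR R m)     ≈⟨ -‿cong (natR-* x m) ⟨
    - natR R (x ℕ.* m)          ≈⟨ -‿cong (+-inverseʳ-unique 1# _ 1+xm≈0) ⟩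
    - - 1#                      ≈⟨ -‿involutive 1# ⟩
    1#                          ∎)
    where
    1+xm≈0 : 1# + natR R (x ℕ.* m) ≈ 0#
    1+xm≈0 = trans (reflexive (≡.cong (natR R) 1+xm≡yN)) (natR-N≈0 y)

  natR-cancel : ∀ {m z} → 0 < m → m < p → natR R m * z ≈ 0# → z ≈ 0#
  natR-cancel {m} {z} 0<m m<p mz≈0 with natR-invertible 0<m m<p
  ... | u , um≈1 = begin
    z                     ≈⟨ *-identityˡ z ⟨
    1# * z                ≈⟨ *-congʳ um≈1 ⟨
    u * natR R m * z      ≈⟨ *-assoc u _ z ⟩
    u * (natR R m * z)    ≈⟨ *-congˡ mz≈0 ⟩
    u * 0#                ≈⟨ zeroʳ u ⟩
    0#                    ∎

  natR-*-cancel-< : ∀ {t u z} → t < u → u < p → natR R t * z ≈ natR R u * z → z ≈ 0#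
  natR-*-cancel-< {t} {u} {z} t<u u<p tz≈uz =
    natR-cancel (ℕₚ.m<n⇒0<n∸m t<u) (ℕₚ.≤-<-trans (ℕₚ.m∸n≤m u t) u<p) (+-cancelˡ (natR R t * z) _ _ (begin
      natR R t * z + natR R (u ℕ.∸ t) * z   ≈⟨ distribʳ z _ _ ⟨
      (natR R t + natR R (u ℕ.∸ t)) * z     ≈⟨ *-congʳ (natR-+ t (u ℕ.∸ t)) ⟨
      natR R (t ℕ.+ (u ℕ.∸ t)) * z          ≡⟨ ≡.cong (λ k → natR R k * z) (ℕₚ.m+[n∸m]≡n (ℕₚ.<⇒≤ t<u)) ⟩
      natR R u * z                          ≈⟨ tz≈uz ⟨
      natR R t * z                          ≈⟨ +-identityʳ _ ⟨
      natR R t * z + 0#                     ∎))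

  natR-*-cancel : ∀ {t u z} → t ≢ u → t < p → u < p → natR R t * z ≈ natR R u * z → z ≈ 0#
  natR-*-cancel {t} {u} t≢u t<p u<p tz≈uz with ℕₚ.<-cmp t u
  ... | tri< t<u _ _ = natR-*-cancel-< t<u u<p tz≈uz
  ... | tri≈ _ t≡u _ = ⊥-elim (t≢u t≡u)
  ... | tri> _ _ u<t = natR-*-cancel-< u<t t<p (sym tz≈uz)

  intR≉0 : ∀ {c} → c ≢ + 0 → ∣ c ∣ < p → ¬ (intR R c ≈ 0#)
  intR≉0 {+ zero}    c≢0 _   = ⊥-elim (c≢0 ≡.refl)
  intR≉0 {+ suc k}   _   c<p = proj₂ (proj₂ char) (suc k) (s≤s z≤n) (ℕₚ.<-≤-trans c<p p≤N)
  intR≉0 { -[1+ k ]} _   c<p -c≈0 = proj₂ (proj₂ char) (suc k) (s≤s z≤n) (ℕₚ.<-≤-trans c<p p≤N)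
    (trans (sym (-‿involutive _)) (trans (-‿cong -c≈0) -0#≈0#))

-- Univariate polynomials and their roots

module Univariate {a ℓ} (R : CommutativeRing a ℓ) where
  open CommutativeRing R
  open import Relation.Binary.Reasoning.Setoid setoid
  open import Algebra.Solver.Ring.NaturalCoefficients.Default commutativeSemiring
    using (solve; _:+_; _:*_; _:=_; con)

  UPoly : Set a
  UPoly = List Carrier

  infixl 6 _+ₚ_
  infixl 7 _*ₚ_
  infixr 7 _·ₚ_

  ⟦_⟧ : UPoly → Carrier → Carrier
  ⟦ []    ⟧ x = 0#
  ⟦ c ∷ f ⟧ x = c + x * ⟦ f ⟧ x

  coef : UPoly → ℕ → Carrier
  coef []      k       = 0#
  coef (c ∷ f) zero    = c
  coef (c ∷ f) (suc k) = coef f k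

  _+ₚ_ : UPoly → UPoly → UPoly
  []      +ₚ g       = g
  (c ∷ f) +ₚ []      = c ∷ f
  (c ∷ f) +ₚ (d ∷ g) = c + d ∷ f +ₚ g

  _·ₚ_ : Carrier → UPoly → UPoly
  c ·ₚ f = List.map (c *_) f

  _*ₚ_ : UPoly → UPoly → UPoly
  []      *ₚ g = []
  (c ∷ f) *ₚ g = c ·ₚ g +ₚ (0# ∷ f *ₚ g)

  ⟦+ₚ⟧ : ∀ f g x → ⟦ f +ₚ g ⟧ x ≈ ⟦ f ⟧ x + ⟦ g ⟧ x
  ⟦+ₚ⟧ []      g       x = sym (+-identityˡ _)
  ⟦+ₚ⟧ (c ∷ f) []      x = sym (+-identityʳ _)
  ⟦+ₚ⟧ (c ∷ f) (d ∷ g) x = begin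
    c + d + x * ⟦ f +ₚ g ⟧ x                 ≈⟨ +-congˡ (*-congˡ (⟦+ₚ⟧ f g x)) ⟩
    c + d + x * (⟦ f ⟧ x + ⟦ g ⟧ x)          ≈⟨ solve 5 (λ c d x u v → c :+ d :+ x :* (u :+ v) := (c :+ x :* u) :+ (d :+ x :* v))
                                                  refl c d x (⟦ f ⟧ x) (⟦ g ⟧ x) ⟩
    (c + x * ⟦ f ⟧ x) + (d + x * ⟦ g ⟧ x)    ∎

  ⟦·ₚ⟧ : ∀ c f x → ⟦ c ·ₚ f ⟧ x ≈ c * ⟦ f ⟧ x
  ⟦·ₚ⟧ c []      x = sym (zeroʳ c)
  ⟦·ₚ⟧ c (d ∷ f) x = begin
    c * d + x * ⟦ c ·ₚ f ⟧ x      ≈⟨ +-congˡ (*-congˡ (⟦·ₚ⟧ c f x)) ⟩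
    c * d + x * (c * ⟦ f ⟧ x)     ≈⟨ solve 4 (λ c d x u → c :* d :+ x :* (c :* u) := c :* (d :+ x :* u)) refl c d x (⟦ f ⟧ x) ⟩
    c * (d + x * ⟦ f ⟧ x)         ∎

  ⟦*ₚ⟧ : ∀ f g x → ⟦ f *ₚ g ⟧ x ≈ ⟦ f ⟧ x * ⟦ g ⟧ x
  ⟦*ₚ⟧ []      g x = sym (zeroˡ _)
  ⟦*ₚ⟧ (c ∷ f) g x = begin
    ⟦ c ·ₚ g +ₚ (0# ∷ f *ₚ g) ⟧ x                ≈⟨ ⟦+ₚ⟧ (c ·ₚ g) (0# ∷ f *ₚ g) x ⟩
    ⟦ c ·ₚ g ⟧ x + (0# + x * ⟦ f *ₚ g ⟧ x)       ≈⟨ +-cong (⟦·ₚ⟧ c g x) (+-congˡ (*-congˡ (⟦*ₚ⟧ f g x))) ⟩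
    c * ⟦ g ⟧ x + (0# + x * (⟦ f ⟧ x * ⟦ g ⟧ x)) ≈⟨ solve 4 (λ c x u v → c :* v :+ (con 0 :+ x :* (u :* v)) := (c :+ x :* u) :* v)
                                                      refl c x (⟦ f ⟧ x) (⟦ g ⟧ x) ⟩
    (c + x * ⟦ f ⟧ x) * ⟦ g ⟧ x                  ∎

  length-+ₚ : ∀ {n} f g → length f ≤ n → length g ≤ n → length (f +ₚ g) ≤ n
  length-+ₚ []      g       f≤n       g≤n       = g≤n
  length-+ₚ (c ∷ f) []      f≤n       g≤n       = f≤n
  length-+ₚ (c ∷ f) (d ∷ g) (s≤s f≤n) (s≤s g≤n) = s≤s (length-+ₚ f g f≤n g≤n)

  length-·ₚ : ∀ c f → length (c ·ₚ f) ≡ length f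
  length-·ₚ c f = Listₚ.length-map (c *_) f

  coef-+ₚ : ∀ f g k → coef (f +ₚ g) k ≈ coef f k + coef g k
  coef-+ₚ []      g       k       = sym (+-identityˡ _)
  coef-+ₚ (c ∷ f) []      zero    = sym (+-identityʳ _)
  coef-+ₚ (c ∷ f) []      (suc k) = sym (+-identityʳ _)
  coef-+ₚ (c ∷ f) (d ∷ g) zero    = refl
  coef-+ₚ (c ∷ f) (d ∷ g) (suc k) = coef-+ₚ f g k

  coef-·ₚ : ∀ c f k → coef (c ·ₚ f) k ≈ c * coef f k
  coef-·ₚ c []      k       = sym (zeroʳ c)
  coef-·ₚ c (d ∷ f) zero    = refl
  coef-·ₚ c (d ∷ f) (suc k) = coef-·ₚ c f k

  coef-beyond : ∀ f {k} → length f ≤ k → coef f k ≈ 0#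
  coef-beyond []      _         = refl
  coef-beyond (c ∷ f) (s≤s f≤k) = coef-beyond f f≤k

  length-*ₚ : ∀ {A B} f g → length f ≤ suc A → length g ≤ suc B → length (f *ₚ g) ≤ suc (A ℕ.+ B)
  length-*ₚ             []          g _                g≤B = z≤n
  length-*ₚ {zero}  {B} (c ∷ [])    g _                g≤B =
    length-+ₚ (c ·ₚ g) (0# ∷ []) (ℕₚ.≤-trans (ℕₚ.≤-reflexive (length-·ₚ c g)) g≤B) (s≤s z≤n)
  length-*ₚ {suc A} {B} (c ∷ f)     g (s≤s f≤A)        g≤B =
    length-+ₚ (c ·ₚ g) (0# ∷ f *ₚ g)
      (ℕₚ.≤-trans (ℕₚ.≤-reflexive (length-·ₚ c g)) (ℕₚ.≤-trans g≤B (s≤s (ℕₚ.≤-trans (ℕₚ.m≤n+m B A) (ℕₚ.n≤1+n _)))))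
      (s≤s (length-*ₚ f g f≤A g≤B))
  length-*ₚ {zero}      (c ∷ _ ∷ _) g (s≤s ())       g≤B

  coef-*ₚ : ∀ {A B} f g → length f ≤ suc A → length g ≤ suc B → coef (f *ₚ g) (A ℕ.+ B) ≈ coef f A * coef g B
  coef-*ₚ             []       g _         g≤B = sym (zeroˡ _)
  coef-*ₚ {zero}  {B} (c ∷ []) g _         g≤B = begin
    coef (c ·ₚ g +ₚ (0# ∷ [])) B        ≈⟨ coef-+ₚ (c ·ₚ g) (0# ∷ []) B ⟩
    coef (c ·ₚ g) B + coef (0# ∷ []) B  ≈⟨ +-cong (coef-·ₚ c g B) (coef-0# B) ⟩
    c * coef g B + 0#                   ≈⟨ +-identityʳ _ ⟩
    c * coef g B                        ∎
    where
    coef-0# : ∀ k → coef (0# ∷ []) k ≈ 0#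
    coef-0# zero    = refl
    coef-0# (suc k) = refl
  coef-*ₚ {zero}      (c ∷ _ ∷ _) g (s≤s ()) g≤B
  coef-*ₚ {suc A} {B} (c ∷ f)  g (s≤s f≤A) g≤B = begin
    coef (c ·ₚ g +ₚ (0# ∷ f *ₚ g)) (suc (A ℕ.+ B))                 ≈⟨ coef-+ₚ (c ·ₚ g) _ (suc (A ℕ.+ B)) ⟩
    coef (c ·ₚ g) (suc (A ℕ.+ B)) + coef (f *ₚ g) (A ℕ.+ B)        ≈⟨ +-cong (coef-·ₚ c g _) (coef-*ₚ f g f≤A g≤B) ⟩
    c * coef g (suc (A ℕ.+ B)) + coef f A * coef g B               ≈⟨ +-congʳ (*-congˡ g-vanishes) ⟩
    c * 0# + coef f A * coef g B                                   ≈⟨ +-congʳ (zeroʳ c) ⟩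
    0# + coef f A * coef g B                                       ≈⟨ +-identityˡ _ ⟩
    coef f A * coef g B                                            ∎
    where
    g-vanishes = coef-beyond g (ℕₚ.≤-trans g≤B (s≤s (ℕₚ.m≤n+m B A)))

  record PolyFn (D : ℕ) (α : Carrier) (g : Carrier → Carrier) : Set (a ⊔ ℓ) where
    constructor polyFn
    field
      poly       : UPoly
      length≤    : length poly ≤ suc D
      coef-top   : coef poly D ≈ α
      represents : ∀ x → g x ≈ ⟦ poly ⟧ x

  polyFn-0# : ∀ D → PolyFn D 0# (λ _ → 0#)
  polyFn-0# D = polyFn [] z≤n refl (λ _ → refl)

  polyFn-const : ∀ c → PolyFn 0 c (λ _ → c)
  polyFn-const c = polyFn (c ∷ []) (s≤s z≤n) refl (λ x → sym (trans (+-congˡ (zeroʳ x)) (+-identityʳ c)))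

  polyFn-id : PolyFn 1 1# (λ x → x)
  polyFn-id = polyFn (0# ∷ 1# ∷ []) ℕₚ.≤-refl refl
    (λ x → solve 1 (λ x → x := con 0 :+ x :* (con 1 :+ x :* con 0)) refl x)

  polyFn-resp : ∀ {D α β g h} → (∀ x → g x ≈ h x) → α ≈ β → PolyFn D α g → PolyFn D β h
  polyFn-resp g≈h α≈β (polyFn f f≤D top rep) = polyFn f f≤D (trans top α≈β) (λ x → trans (sym (g≈h x)) (rep x))

  polyFn-subst : ∀ {D D′ α g} → D ≡ D′ → PolyFn D α g → PolyFn D′ α g
  polyFn-subst ≡.refl q = q

  polyFn-raise : ∀ {A B α g} → A < B → PolyFn A α g → PolyFn B 0# g
  polyFn-raise A<B (polyFn f f≤A _ rep) =
    polyFn f (ℕₚ.≤-trans f≤A (ℕₚ.≤-trans A<B (ℕₚ.n≤1+n _))) (coef-beyond f (ℕₚ.≤-trans f≤A A<B)) rep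

  polyFn-+ : ∀ {D α β g h} → PolyFn D α g → PolyFn D β h → PolyFn D (α + β) (λ x → g x + h x)
  polyFn-+ {D} (polyFn f f≤D f-top f-rep) (polyFn f′ f′≤D f′-top f′-rep) =
    polyFn (f +ₚ f′) (length-+ₚ f f′ f≤D f′≤D) (trans (coef-+ₚ f f′ D) (+-cong f-top f′-top))
      (λ x → trans (+-cong (f-rep x) (f′-rep x)) (sym (⟦+ₚ⟧ f f′ x)))

  polyFn-* : ∀ {A B α β g h} → PolyFn A α g → PolyFn B β h → PolyFn (A ℕ.+ B) (α * β) (λ x → g x * h x)
  polyFn-* (polyFn f f≤A f-top f-rep) (polyFn f′ f′≤B f′-top f′-rep) =
    polyFn (f *ₚ f′) (length-*ₚ f f′ f≤A f′≤B) (trans (coef-*ₚ f f′ f≤A f′≤B) (*-cong f-top f′-top))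
      (λ x → trans (*-cong (f-rep x) (f′-rep x)) (sym (⟦*ₚ⟧ f f′ x)))

  polyFn-^ : ∀ {D α g} e → PolyFn D α g → PolyFn (e ℕ.* D) (powR R α e) (λ x → powR R (g x) e)
  polyFn-^ zero    _ = polyFn-const 1#
  polyFn-^ (suc e) q = polyFn-* q (polyFn-^ e q)

  quot : UPoly → Carrier → UPoly
  quot []      r = []
  quot (c ∷ f) r = f +ₚ r ·ₚ quot f r

  -- f(x) − f(r) = (x − r) · quot f r (x), rearranged so that no subtraction occurs.
  ⟦quot⟧ : ∀ f r x → ⟦ f ⟧ x + r * ⟦ quot f r ⟧ x ≈ ⟦ f ⟧ r + x * ⟦ quot f r ⟧ x
  ⟦quot⟧ []      r x = trans (+-congˡ (zeroʳ r)) (sym (+-congˡ (zeroʳ x)))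
  ⟦quot⟧ (c ∷ f) r x = begin
    (c + x * ⟦ f ⟧ x) + r * ⟦ quot (c ∷ f) r ⟧ x
      ≈⟨ +-congˡ (*-congˡ (⟦quot-∷⟧ x)) ⟩
    (c + x * ⟦ f ⟧ x) + r * (⟦ f ⟧ x + r * q)
      ≈⟨ +-congˡ (*-congˡ (⟦quot⟧ f r x)) ⟩
    (c + x * ⟦ f ⟧ x) + r * (⟦ f ⟧ r + x * q)
      ≈⟨ solve 6 (λ c x r fx fr q → (c :+ x :* fx) :+ r :* (fr :+ x :* q) := (c :+ r :* fr) :+ x :* (fx :+ r :* q))
                 refl c x r (⟦ f ⟧ x) (⟦ f ⟧ r) q ⟩
    (c + r * ⟦ f ⟧ r) + x * (⟦ f ⟧ x + r * q)
      ≈⟨ +-congˡ (*-congˡ (⟦quot-∷⟧ x)) ⟨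
    (c + r * ⟦ f ⟧ r) + x * ⟦ quot (c ∷ f) r ⟧ x
      ∎
    where
    q = ⟦ quot f r ⟧ x
    ⟦quot-∷⟧ : ∀ y → ⟦ quot (c ∷ f) r ⟧ y ≈ ⟦ f ⟧ y + r * ⟦ quot f r ⟧ y
    ⟦quot-∷⟧ y = trans (⟦+ₚ⟧ f (r ·ₚ quot f r) y) (+-congˡ (⟦·ₚ⟧ r (quot f r) y))

  length-quot : ∀ f r → length (quot f r) ≤ ℕ.pred (length f)
  length-quot []      r = z≤n
  length-quot (c ∷ f) r = length-+ₚ f (r ·ₚ quot f r) ℕₚ.≤-refl
    (ℕₚ.≤-trans (ℕₚ.≤-reflexive (length-·ₚ r (quot f r))) (ℕₚ.≤-trans (length-quot f r) ℕₚ.pred[n]≤n))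

  coef-quot : ∀ f r k → length f ≤ suc (suc k) → coef (quot f r) k ≈ coef f (suc k)
  coef-quot []      r k _         = refl
  coef-quot (c ∷ f) r k (s≤s f≤k) = begin
    coef (f +ₚ r ·ₚ quot f r) k               ≈⟨ coef-+ₚ f _ k ⟩
    coef f k + coef (r ·ₚ quot f r) k         ≈⟨ +-congˡ (coef-·ₚ r (quot f r) k) ⟩
    coef f k + r * coef (quot f r) k          ≈⟨ +-congˡ (*-congˡ quot-vanishes) ⟩
    coef f k + r * 0#                         ≈⟨ +-congˡ (zeroʳ r) ⟩
    coef f k + 0#                             ≈⟨ +-identityʳ _ ⟩
    coef f k                                  ∎
    where
    quot-vanishes = coef-beyond (quot f r) (ℕₚ.≤-trans (length-quot f r) (ℕₚ.pred-mono-≤ f≤k))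

module RootBound {a ℓ} (R : CommutativeRing a ℓ) {N p : ℕ}
                 (char : IsCharacteristic R N) (lpf : IsLeastPrimeFactor N p) where
  open CommutativeRing R
  open import Relation.Binary.Reasoning.Setoid setoid
  open Univariate R
  open Characteristic R char lpf using (natR-*-cancel)

  VanishesOn : UPoly → List ℕ → Set ℓ
  VanishesOn f ts = All (λ t → ⟦ f ⟧ (natR R t) ≈ 0#) ts

  quot-vanishesOn : ∀ f {t} ts → All (t ≢_) ts → t < p → All (_< p) ts → ⟦ f ⟧ (natR R t) ≈ 0# →
                    VanishesOn f ts → VanishesOn (quot f (natR R t)) ts
  quot-vanishesOn f []       _             _   _             _     _              = []
  quot-vanishesOn f {t} (u ∷ ts) (t≢u ∷ t≢ts) t<p (u<p ∷ ts<p) f[t]≈0 (f[u]≈0 ∷ f[ts]≈0) =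
    natR-*-cancel t≢u t<p u<p (begin
      natR R t * q                   ≈⟨ +-identityˡ _ ⟨
      0# + natR R t * q              ≈⟨ +-congʳ f[u]≈0 ⟨
      ⟦ f ⟧ (natR R u) + natR R t * q ≈⟨ ⟦quot⟧ f (natR R t) (natR R u) ⟩
      ⟦ f ⟧ (natR R t) + natR R u * q ≈⟨ +-congʳ f[t]≈0 ⟩
      0# + natR R u * q              ≈⟨ +-identityˡ _ ⟩
      natR R u * q                   ∎)
    ∷ quot-vanishesOn f ts t≢ts t<p ts<p f[t]≈0 f[ts]≈0
    where q = ⟦ quot f (natR R t) ⟧ (natR R u)

  coef≈0-of-roots : ∀ L f ts → length ts ≡ suc L → AllPairs _≢_ ts → All (_< p) ts → VanishesOn f ts →
                    length f ≤ suc L → coef f L ≈ 0#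
  coef≈0-of-roots zero    []          ts       _ _ _ _ _ = refl
  coef≈0-of-roots zero    (c ∷ [])    (t ∷ ts) _ _ _ (c≈0 ∷ _) _ =
    trans (sym (trans (+-congˡ (zeroʳ (natR R t))) (+-identityʳ c))) c≈0
  coef≈0-of-roots zero    (_ ∷ _ ∷ _) _        _ _ _ _ (s≤s ())
  coef≈0-of-roots (suc L) f (t ∷ ts) |ts| (t≢ts ∷ distinct) (t<p ∷ ts<p) (f[t]≈0 ∷ f[ts]≈0) f≤L =
    trans (sym (coef-quot f (natR R t) L f≤L))
      (coef≈0-of-roots L (quot f (natR R t)) ts (ℕₚ.suc-injective |ts|) distinct ts<p
        (quot-vanishesOn f ts t≢ts t<p ts<p f[t]≈0 f[ts]≈0)
        (ℕₚ.≤-trans (length-quot f (natR R t)) (ℕₚ.pred-mono-≤ f≤L)))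

  #roots≤degree : ∀ {L α g} → PolyFn L α g → ¬ (α ≈ 0#) →
                  ∀ {q} {Z : ℕ → Set q} (Z? : Decidable Z) → (∀ t → Z t → g (natR R t) ≈ 0#) →
                  length (filter Z? (upTo p)) ≤ L
  #roots≤degree {L} (polyFn f f≤L top rep) α≉0 Z? Z⇒root with length (filter Z? (upTo p)) ℕₚ.≤? L
  ... | yes #≤L = #≤L
  ... | no  #≰L = ⊥-elim (α≉0 (trans (sym top)
          (coef≈0-of-roots L f ts |ts| distinct ts<p ts-roots f≤L)))
    where
    ts = take (suc L) (filter Z? (upTo p))
    |ts| : length ts ≡ suc L
    |ts| = ≡.trans (Listₚ.length-take (suc L) (filter Z? (upTo p))) (ℕₚ.m≤n⇒m⊓n≡m (ℕₚ.≰⇒> #≰L))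
    distinct : AllPairs _≢_ ts
    distinct = AllPairsₚ.take⁺ (suc L) (Uniqueₚ.filter⁺ Z? (Uniqueₚ.upTo⁺ p))
    ts<p : All (_< p) ts
    ts<p = Allₚ.take⁺ (suc L) (Allₚ.filter⁺ Z? (All.tabulate ∈-upTo⁻))
    ts-roots : VanishesOn f ts
    ts-roots = All.map (λ {t} Zt → trans (sym (rep (natR R t))) (Z⇒root t Zt))
                       (Allₚ.take⁺ (suc L) (Allₚ.all-filter Z? (upTo p)))

-- Kronecker substitution

module Evaluation {a ℓ} (R : CommutativeRing a ℓ) where
  open CommutativeRing R
  open import Relation.Binary.Reasoning.Setoid setoid
  open import Algebra.Solver.Ring.NaturalCoefficients.Default commutativeSemiring
    using (solve; _:+_; _:*_; _:=_)
  open Multiples R using (intR-+)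

  infixl 6 _⊕_
  _⊕_ : ∀ {n} → Vec Carrier n → Vec Carrier n → Vec Carrier n
  _⊕_ = Vec.zipWith _+_

  powR-cong : ∀ {x y} e → x ≈ y → powR R x e ≈ powR R y e
  powR-cong zero    x≈y = refl
  powR-cong (suc e) x≈y = *-cong x≈y (powR-cong e x≈y)

  powR-1# : ∀ e → powR R 1# e ≈ 1#
  powR-1# zero    = refl
  powR-1# (suc e) = trans (*-identityˡ _) (powR-1# e)

  monoR-cong : ∀ {n} {u v : Vec Carrier n} es → Pointwise _≈_ u v → monoR R u es ≈ monoR R v es
  monoR-cong []       []          = refl
  monoR-cong (e ∷ es) (x≈y ∷ u≈v) = *-cong (powR-cong e x≈y) (monoR-cong es u≈v)

  evalR-cong : ∀ {n} (Q : Poly n) {u v : Vec Carrier n} → Pointwise _≈_ u v → evalR R Q u ≈ evalR R Q v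
  evalR-cong []             u≈v = refl
  evalR-cong ((c , e) ∷ Q) u≈v = +-cong (*-congˡ (monoR-cong e u≈v)) (evalR-cong Q u≈v)

  evalR-dropExponent : ∀ {n} e (Q : Poly n) y →
                       evalR R Q y ≈ evalR R (dropExponent e Q) y + intR R (coeff Q e) * monoR R y e
  evalR-dropExponent e []              y = sym (trans (+-congˡ (zeroˡ _)) (+-identityʳ 0#))
  evalR-dropExponent e ((c , e′) ∷ Q) y with ≡-dec ℕ._≟_ e′ e
  ... | yes ≡.refl = begin
    intR R c * m + evalR R Q y                           ≈⟨ +-congˡ (evalR-dropExponent e Q y) ⟩
    intR R c * m + (E + intR R (coeff Q e) * m)          ≈⟨ solve 4 (λ a b m E → a :* m :+ (E :+ b :* m) := E :+ (a :+ b) :* m)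
                                                              refl (intR R c) (intR R (coeff Q e)) m E ⟩
    E + (intR R c + intR R (coeff Q e)) * m              ≈⟨ +-congˡ (*-congʳ (intR-+ c (coeff Q e))) ⟨
    E + intR R (c ℤ.+ coeff Q e) * m                     ∎
    where
    m = monoR R y e
    E = evalR R (dropExponent e Q) y
  ... | no _ = trans (+-congˡ (evalR-dropExponent e Q y)) (sym (+-assoc _ _ _))

module Kronecker {a ℓ} (R : CommutativeRing a ℓ) (M : ℕ) .{{_ : NonZero M}} where
  open CommutativeRing R
  open Univariate R
  open Evaluation R

  curve : ∀ {n} → Carrier → Vec Carrier n
  curve {zero}  x = []
  curve {suc n} x = x ∷ curve (powR R x M)

  monoR-alongCurve : ∀ {n} (ys : Vec Carrier n) es {D h} → 0 < D → PolyFn D 1# h →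
                     PolyFn (weight M es ℕ.* D) 1# (λ x → monoR R (ys ⊕ curve (h x)) es)
  monoR-alongCurve []       []       _   _       = polyFn-const 1#
  monoR-alongCurve (y ∷ ys) (e ∷ es) {D} {h} 0<D h-monic =
    polyFn-subst degree (polyFn-resp (λ _ → refl) (*-identityˡ 1#) (polyFn-* head tail))
    where
    y+h : PolyFn D 1# (λ x → y + h x)
    y+h = polyFn-resp (λ _ → refl) (+-identityˡ 1#) (polyFn-+ (polyFn-raise 0<D (polyFn-const y)) h-monic)
    head : PolyFn (e ℕ.* D) 1# (λ x → powR R (y + h x) e)
    head = polyFn-resp (λ _ → refl) (powR-1# e) (polyFn-^ e y+h)
    tail : PolyFn (weight M es ℕ.* (M ℕ.* D)) 1# (λ x → monoR R (ys ⊕ curve (powR R (h x) M)) es)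
    tail = monoR-alongCurve ys es (ℕₚ.*-mono-≤ (ℕ.>-nonZero⁻¹ M) 0<D)
             (polyFn-resp (λ _ → refl) (powR-1# M) (polyFn-^ M h-monic))
    degree : e ℕ.* D ℕ.+ weight M es ℕ.* (M ℕ.* D) ≡ weight M (e ∷ es) ℕ.* D
    degree = ≡.sym (≡.trans (ℕₚ.*-distribʳ-+ D e _) (≡.cong (ℕ._+_ (e ℕ.* D)) (ℕₚ.*-assoc (weight M es) M D)))

  term-alongCurve : ∀ {n} (ys : Vec Carrier n) c e →
                    PolyFn (weight M e) (intR R c) (λ x → intR R c * monoR R (ys ⊕ curve x) e)
  term-alongCurve ys c e = polyFn-resp (λ _ → refl) (*-identityʳ _) (polyFn-* (polyFn-const (intR R c))
    (polyFn-subst (ℕₚ.*-identityʳ (weight M e)) (monoR-alongCurve ys e (s≤s z≤n) polyFn-id)))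

  evalR-alongCurve-< : ∀ {n L} (Q : Poly n) → All (λ u → weight M (proj₂ u) < L) Q →
                       ∀ ys → PolyFn L 0# (λ x → evalR R Q (ys ⊕ curve x))
  evalR-alongCurve-< {L = L} []             []          ys = polyFn-0# L
  evalR-alongCurve-<          ((c , e) ∷ Q) (e<L ∷ Q<L) ys = polyFn-resp (λ _ → refl) (+-identityʳ 0#)
    (polyFn-+ (polyFn-raise e<L (term-alongCurve ys c e)) (evalR-alongCurve-< Q Q<L ys))

  Bounded : ∀ {n} → Poly n → Set
  Bounded Q = All (λ u → VecAll.All (_< M) (proj₂ u)) Q

  record LeadingTerm {n} (Q : Poly n) : Set (a ⊔ ℓ) where
    field
      term        : ℤ × Vec ℕ n
      term∈Q      : term ∈ Q
      coeff≢0     : coeff Q (proj₂ term) ≢ + 0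
      alongCurves : ∀ ys → PolyFn (weight M (proj₂ term)) (intR R (coeff Q (proj₂ term)))
                                  (λ x → evalR R Q (ys ⊕ curve x))

  leadingTerm-heaviest : ∀ {n} (Q : Poly n) {u} → u ∈ Q → All (λ v → weight M (proj₂ v) ≤ weight M (proj₂ u)) Q →
                         Bounded Q → coeff Q (proj₂ u) ≢ + 0 → LeadingTerm Q
  leadingTerm-heaviest Q {u} u∈Q ≤u bounded c≢0 = record
    { term        = u
    ; term∈Q      = u∈Q
    ; coeff≢0     = c≢0
    ; alongCurves = λ ys → polyFn-resp (λ x → sym (evalR-dropExponent eᵤ Q (ys ⊕ curve x))) (+-identityˡ _)
                             (polyFn-+ (evalR-alongCurve-< (dropExponent eᵤ Q) lighter ys) (term-alongCurve ys (coeff Q eᵤ) eᵤ))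
    }
    where
    eᵤ = proj₂ u
    lighter : All (λ v → weight M (proj₂ v) < weight M eᵤ) (dropExponent eᵤ Q)
    lighter = All.tabulate λ {v} v∈ → ℕₚ.≤∧≢⇒< (All.lookup ≤u (dropExponent-⊆ eᵤ Q v∈))
      (λ same-weight → All.lookup (dropExponent-≢ eᵤ Q) v∈
        (weight-injective M (All.lookup bounded (dropExponent-⊆ eᵤ Q v∈)) (All.lookup bounded u∈Q) same-weight))

  leadingTerm-dropExponent : ∀ {n e} (Q : Poly n) → coeff Q e ≡ + 0 → LeadingTerm (dropExponent e Q) → LeadingTerm Q
  leadingTerm-dropExponent {e = e} Q cancels lt = record
    { term        = term
    ; term∈Q      = dropExponent-⊆ e Q term∈Q
    ; coeff≢0     = λ c≡0 → coeff≢0 (≡.trans same-coeff c≡0)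
    ; alongCurves = λ ys → polyFn-resp (λ x → sym (same-value (ys ⊕ curve x))) (reflexive (≡.cong (intR R) same-coeff))
                             (alongCurves ys)
    }
    where
    open LeadingTerm lt
    same-coeff : coeff (dropExponent e Q) (proj₂ term) ≡ coeff Q (proj₂ term)
    same-coeff = coeff-dropExponent Q (All.lookup (dropExponent-≢ e Q) term∈Q)
    same-value : ∀ v → evalR R Q v ≈ evalR R (dropExponent e Q) v
    same-value v = trans (evalR-dropExponent e Q v)
      (trans (+-congˡ (trans (*-congʳ (reflexive (≡.cong (intR R) cancels))) (zeroˡ _))) (+-identityʳ _))

  heaviest : ∀ {n} → ℤ × Vec ℕ n → Poly n → ℤ × Vec ℕ n
  heaviest = argmax (λ u → weight M (proj₂ u))

  heaviest∈ : ∀ {n} t (Q : Poly n) → heaviest t Q ∈ t ∷ Q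
  heaviest∈ t Q with argmax-sel (λ u → weight M (proj₂ u)) t Q
  ... | inj₁ ≡t = here ≡t
  ... | inj₂ ∈Q = there ∈Q

  ≤heaviest : ∀ {n} t (Q : Poly n) → All (λ v → weight M (proj₂ v) ≤ weight M (proj₂ (heaviest t Q))) (t ∷ Q)
  ≤heaviest t Q = f[⊥]≤f[argmax] {f = λ u → weight M (proj₂ u)} t Q ∷ f[xs]≤f[argmax] t Q

  -- A cancelling heaviest exponent is dropped; a surviving one leads, because all other
  -- exponents are lighter (weight M is injective on exponents below M).
  leadingTerm : ∀ {n} (Q : Poly n) → Bounded Q → ∀ {e₀} → coeff Q e₀ ≢ + 0 → Acc _<_ (length Q) → LeadingTerm Q
  leadingTerm []          _       c≢0 _ = ⊥-elim (c≢0 ≡.refl)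
  leadingTerm Q@(t ∷ Q′) bounded {e₀} c≢0 (acc rec) with coeff Q (proj₂ (heaviest t Q′)) ℤ.≟ + 0
  ... | no  top≢0 = leadingTerm-heaviest Q (heaviest∈ t Q′) (≤heaviest t Q′) bounded top≢0
  ... | yes top≡0 = leadingTerm-dropExponent Q top≡0
    (leadingTerm (dropExponent eₘ Q) (All-resp-⊇ (dropExponent-⊆ eₘ Q) bounded) c≢0′
      (rec (length-dropExponent< eₘ Q (heaviest∈ t Q′))))
    where
    eₘ = proj₂ (heaviest t Q′)
    c≢0′ : coeff (dropExponent eₘ Q) e₀ ≢ + 0
    c≢0′ = ≡.subst (_≢ + 0) (≡.sym (coeff-dropExponent Q (λ e₀≡eₘ → c≢0 (≡.trans (≡.cong (coeff Q) e₀≡eₘ) top≡0)))) c≢0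

-- Counting zeros

module Counting {a ℓ} (R : CommutativeRing a ℓ) (F : Finite R) where
  open CommutativeRing R
  open Finite F
  open Evaluation R using (_⊕_)
  open ≡-Reasoning

  vals : ∀ {n} → Vec (Fin size) n → Vec Carrier n
  vals = Vec.map enum

  ∑-allVecs-suc : ∀ n (W : Vec (Fin size) (suc n) → ℕ) →
                  ∑ (allVecs R size (suc n)) W ≡ ∑[ i ∈ allFin size ] ∑[ ys ∈ allVecs R size n ] W (i ∷ ys)
  ∑-allVecs-suc n W = ≡.trans (∑-concatMap _ (allFin size) W)
                              (∑-cong (allFin size) (λ i → ∑-map (i ∷_) (allVecs R size n) W))

  length-allVecs : ∀ n → length (allVecs R size n) ≡ size ℕ.^ n
  length-allVecs zero    = ≡.refl
  length-allVecs (suc n) = begin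
    length (allVecs R size (suc n))
      ≡⟨ length≡∑1 (allVecs R size (suc n)) ⟩
    ∑[ ys ∈ allVecs R size (suc n) ] 1
      ≡⟨ ∑-allVecs-suc n (λ _ → 1) ⟩
    ∑[ i ∈ allFin size ] ∑[ ys ∈ allVecs R size n ] 1
      ≡⟨ ∑-cong (allFin size) (λ _ → ≡.trans (≡.sym (length≡∑1 (allVecs R size n))) (length-allVecs n)) ⟩
    ∑[ i ∈ allFin size ] (size ℕ.^ n)
      ≡⟨ ∑-const (allFin size) (size ℕ.^ n) ⟩
    length (allFin size) ℕ.* size ℕ.^ n
      ≡⟨ ≡.cong (ℕ._* size ℕ.^ n) (Listₚ.length-tabulate {n = size} (λ i → i)) ⟩
    size ℕ.* size ℕ.^ n
      ∎
    where
    length≡∑1 : ∀ {m} (xs : List (Vec (Fin size) m)) → length xs ≡ ∑[ x ∈ xs ] 1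
    length≡∑1 xs = ≡.sym (≡.trans (∑-const xs 1) (ℕₚ.*-identityʳ (length xs)))

  index-cong : ∀ {x y} → x ≈ y → index x ≡ index y
  index-cong {x} {y} x≈y = enum-inj (index x) (index y) (trans (enum-index x) (trans x≈y (sym (enum-index y))))

  index-injective : ∀ {x y} → index x ≡ index y → x ≈ y
  index-injective {x} {y} i≡j = trans (sym (enum-index x)) (trans (reflexive (≡.cong enum i≡j)) (enum-index y))

  ∑-translate₁ : (G : Carrier → ℕ) → (∀ {x y} → x ≈ y → G x ≡ G y) → ∀ g →
                 ∑[ i ∈ allFin size ] G (enum i + g) ≡ ∑[ i ∈ allFin size ] G (enum i)
  ∑-translate₁ G G-cong g = begin
    ∑[ i ∈ allFin size ] G (enum i + g)           ≡⟨ ∑-cong (allFin size) (λ i → G-cong (sym (enum-index (enum i + g)))) ⟩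
    ∑[ i ∈ allFin size ] G (enum (shift i))       ≡⟨ ∑-allFin-permute (λ i → G (enum i)) shift unshift shift∘unshift unshift∘shift ⟩
    ∑[ i ∈ allFin size ] G (enum i)               ∎
    where
    shift unshift : Fin size → Fin size
    shift   i = index (enum i + g)
    unshift i = index (enum i - g)
    shift∘unshift : ∀ i → shift (unshift i) ≡ i
    shift∘unshift i = enum-inj _ _ (trans (enum-index _) (trans (+-congʳ (enum-index _))
      (trans (+-assoc _ _ _) (trans (+-congˡ (-‿inverseˡ g)) (+-identityʳ _)))))
    unshift∘shift : ∀ i → unshift (shift i) ≡ i
    unshift∘shift i = enum-inj _ _ (trans (enum-index _) (trans (+-congʳ (enum-index _))
      (trans (+-assoc _ _ _) (trans (+-congˡ (-‿inverseʳ g)) (+-identityʳ _)))))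

  ∑-translate : ∀ n (W : Vec Carrier n → ℕ) → (∀ {u v} → Pointwise _≈_ u v → W u ≡ W v) → ∀ g →
                ∑[ y ∈ allVecs R size n ] W (vals y ⊕ g) ≡ ∑[ y ∈ allVecs R size n ] W (vals y)
  ∑-translate zero    W W-cong []       = ≡.refl
  ∑-translate (suc n) W W-cong (g ∷ gs) = begin
    ∑[ y ∈ allVecs R size (suc n) ] W (vals y ⊕ (g ∷ gs))
      ≡⟨ ∑-allVecs-suc n _ ⟩
    ∑[ i ∈ allFin size ] ∑[ ys ∈ allVecs R size n ] W ((enum i + g) ∷ (vals ys ⊕ gs))
      ≡⟨ ∑-cong (allFin size) (λ i → ∑-translate n (λ v → W ((enum i + g) ∷ v)) (λ u≈v → W-cong (refl ∷ u≈v)) gs) ⟩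
    ∑[ i ∈ allFin size ] G (enum i + g)
      ≡⟨ ∑-translate₁ G (λ x≈y → ∑-cong (allVecs R size n) (λ ys → W-cong (x≈y ∷ Pointwise.refl refl))) g ⟩
    ∑[ i ∈ allFin size ] G (enum i)
      ≡⟨ ∑-allVecs-suc n _ ⟨
    ∑[ y ∈ allVecs R size (suc n) ] W (vals y)
      ∎
    where
    G : Carrier → ℕ
    G x = ∑[ ys ∈ allVecs R size n ] W (x ∷ vals ys)

module ZeroCount {a ℓ} (R : CommutativeRing a ℓ) (F : Finite R) {N p : ℕ}
                 (char : IsCharacteristic R N) (lpf : IsLeastPrimeFactor N p) {n : ℕ} (P : Poly n) where
  open CommutativeRing R
  open Finite F
  open Univariate R using (PolyFn)
  open Evaluation R using (_⊕_; evalR-cong)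
  open Counting R F
  open RootBound R char lpf using (#roots≤degree)

  isZero? : (v : Vec Carrier n) → Dec (index (evalR R P v) ≡ index 0#)
  isZero? v = index (evalR R P v) Fin.≟ index 0#

  zeroIndicator : Vec Carrier n → ℕ
  zeroIndicator v = indicator (isZero? v)

  zeroIndicator-cong : ∀ {u v} → Pointwise _≈_ u v → zeroIndicator u ≡ zeroIndicator v
  zeroIndicator-cong u≈v = ≡.cong (λ i → indicator (i Fin.≟ index 0#)) (index-cong (evalR-cong P u≈v))

  countZeros≡∑ : countZeros R F P ≡ ∑[ y ∈ allVecs R size n ] zeroIndicator (vals y)
  countZeros≡∑ = length-filter≡∑ (λ y → isZero? (vals y)) (allVecs R size n)

  countZeros≤ : countZeros R F P ≤ size ℕ.^ n
  countZeros≤ = ℕₚ.≤-trans (Listₚ.length-filter (λ y → isZero? (vals y)) (allVecs R size n))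
                           (ℕₚ.≤-reflexive (length-allVecs n))

  -- Count the pairs (y, t), t < p, with P(y + h t) = 0: for fixed t there are
  -- countZeros of them, since y ↦ y + h t permutes Rⁿ; for fixed y at most L.
  lpf*countZeros≤ : ∀ (h : Carrier → Vec Carrier n) {L α} → ¬ (α ≈ 0#) →
                    (∀ ys → PolyFn L α (λ x → evalR R P (ys ⊕ h x))) →
                    p ℕ.* countZeros R F P ≤ size ℕ.^ n ℕ.* L
  lpf*countZeros≤ h {L} α≉0 alongCurves = begin
    p ℕ.* countZeros R F P
      ≡⟨ ≡.cong (ℕ._* countZeros R F P) (Listₚ.length-upTo p) ⟨
    length (upTo p) ℕ.* countZeros R F P
      ≡⟨ ∑-const (upTo p) (countZeros R F P) ⟨
    ∑[ t ∈ upTo p ] countZeros R F P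
      ≡⟨ ∑-cong (upTo p) (λ t → ≡.trans countZeros≡∑
           (≡.sym (∑-translate n zeroIndicator zeroIndicator-cong (h (natR R t))))) ⟩
    ∑[ t ∈ upTo p ] ∑[ y ∈ allVecs R size n ] zeroIndicator (vals y ⊕ h (natR R t))
      ≡⟨ ∑-swap (upTo p) (allVecs R size n) (λ t y → zeroIndicator (vals y ⊕ h (natR R t))) ⟩
    ∑[ y ∈ allVecs R size n ] ∑[ t ∈ upTo p ] zeroIndicator (vals y ⊕ h (natR R t))
      ≤⟨ ∑-≤ (allVecs R size n) #roots≤L ⟩
    length (allVecs R size n) ℕ.* L
      ≡⟨ ≡.cong (ℕ._* L) (length-allVecs n) ⟩
    size ℕ.^ n ℕ.* L
      ∎
    where
    open ℕₚ.≤-Reasoning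
    #roots≤L : ∀ y → ∑[ t ∈ upTo p ] zeroIndicator (vals y ⊕ h (natR R t)) ≤ L
    #roots≤L y = ≡.subst (_≤ L) (length-filter≡∑ Z? (upTo p))
                   (#roots≤degree (alongCurves (vals y)) α≉0 Z? (λ _ → index-injective))
      where
      Z? = λ t → isZero? (vals y ⊕ h (natR R t))

module _ {n : ℕ} (P : Poly n) where

  exponentBound : ℕ
  exponentBound = suc (∑[ u ∈ P ] totalDeg (proj₂ u))

  kroneckerDegree : ℕ
  kroneckerDegree = ∑[ u ∈ P ] weight exponentBound (proj₂ u)

  coeffNorm : ℕ
  coeffNorm = ∑[ u ∈ P ] ∣ proj₁ u ∣

  lpf*countZeros≤kroneckerDegree :
    ∀ {e₀} → coeff P e₀ ≢ + 0 → ∀ {a ℓ} (R : CommutativeRing a ℓ) (F : Finite R) {N p} →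
    IsCharacteristic R N → IsLeastPrimeFactor N p → coeffNorm < p →
    p ℕ.* countZeros R F P ≤ Finite.size F ℕ.^ n ℕ.* kroneckerDegree
  lpf*countZeros≤kroneckerDegree c₀≢0 R F {p = p} char lpf norm<p =
    ℕₚ.≤-trans (lpf*countZeros≤ curve (intR≉0 coeff≢0 lc<p) alongCurves)
               (ℕₚ.*-monoʳ-≤ (Finite.size F ℕ.^ n) (∈⇒≤∑ (λ u → weight exponentBound (proj₂ u)) term∈Q))
    where
    open Kronecker R exponentBound
    open ZeroCount R F char lpf P using (lpf*countZeros≤)
    open Characteristic R char lpf using (intR≉0)
    bounded : Bounded P
    bounded = All.tabulate λ u∈P → VecAll.map (λ e≤ → s≤s (ℕₚ.≤-trans e≤ (∈⇒≤∑ (λ u → totalDeg (proj₂ u)) u∈P)))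
                                              (entries≤totalDeg _)
    open LeadingTerm (leadingTerm P bounded c₀≢0 (<-wellFounded (length P)))
    lc<p : ∣ coeff P (proj₂ term) ∣ < p
    lc<p = ℕₚ.≤-<-trans (∣coeff∣≤∑∣c∣ P (proj₂ term)) norm<p

open import Data.Nat using (_*_; _∸_; _^_)

square-bound : ∀ {x z p T L} → x ≤ z → z ≤ T → p * z ≤ T * L → x ^ 2 * p ^ 1 ≤ suc L ^ 2 * T ^ 2
square-bound {x} {z} {p} {T} {L} x≤z z≤T pz≤TL = begin
  x ^ 2 * p ^ 1                   ≡⟨ solve 2 (λ x p → x :^ 2 :* p :^ 1 := x :* (p :* x)) ≡.refl x p ⟩
  x * (p * x)                     ≤⟨ ℕₚ.*-mono-≤ x≤z (ℕₚ.*-monoʳ-≤ p x≤z) ⟩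
  z * (p * z)                     ≤⟨ ℕₚ.*-mono-≤ z≤T pz≤TL ⟩
  T * (T * L)                     ≤⟨ ℕₚ.*-monoʳ-≤ T (ℕₚ.*-monoʳ-≤ T (ℕₚ.≤-trans (ℕₚ.n≤1+n L) (ℕₚ.m≤m*n (suc L) (suc L)))) ⟩
  T * (T * (suc L * suc L))       ≡⟨ solve 2 (λ T l → T :* (T :* (l :* l)) := l :^ 2 :* T :^ 2) ≡.refl T (suc L) ⟩
  suc L ^ 2 * T ^ 2               ∎
  where
  open ℕₚ.≤-Reasoning
  open +-*-Solver

proposition3p9 : {a ℓ : Level} (n : ℕ) (P : Poly n) → 1 ≤ n → DegreeAtLeastOne P →
    Σ ℕ λ c → Σ ℕ λ C → Σ ℕ λ α → Σ ℕ λ β →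
      (0 < c) × (0 < C) × (0 < α) × (α < β) ×
      ((R : CommutativeRing a ℓ) → Nontrivial R → (F : Finite R) →
        (N p : ℕ) → IsCharacteristic R N → IsLeastPrimeFactor N p → C < p →
        (countZeros R F P ∸ Finite.size F ^ (n ∸ 1)) ^ β * p ^ α
          ≤ c ^ β * Finite.size F ^ (n * β))
proposition3p9 n P _ (_ , _ , coeff≢0) =
  suc (kroneckerDegree P) , suc (coeffNorm P) , 1 , 2 , s≤s z≤n , s≤s z≤n , s≤s z≤n , s≤s (s≤s z≤n) ,
  λ R _ F N p char lpf norm<p →
    ≡.subst (λ k → (countZeros R F P ∸ Finite.size F ^ (n ∸ 1)) ^ 2 * p ^ 1 ≤ suc (kroneckerDegree P) ^ 2 * k)
      (ℕₚ.^-*-assoc (Finite.size F) n 2)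
      (square-bound {p = p} (ℕₚ.m∸n≤m (countZeros R F P) (Finite.size F ^ (n ∸ 1)))
        (ZeroCount.countZeros≤ R F char lpf P)
        (lpf*countZeros≤kroneckerDegree P coeff≢0 R F char lpf (ℕₚ.<-trans (ℕₚ.n<1+n _) norm<p)))
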